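{- Let $\theta$ be a substitution that is arity type preserving with respect to an arity context $\Theta$, and let $\Theta'=\mathrm{ctx}(\theta)\oplus\Theta$. (1) If $E$ is a canonical type or kind that respects $\Theta'$, then there is an $E'$ that respects $\Theta$ such that $\theta(E)\rightsquigarrow E'$ is derivable. (2) If $M$ is a canonical term such that $\Theta'\vdash M\Leftarrow\alpha$ is derivable, then there is an $M'$ such that $\theta(M)\rightsquigarrow M'$ and $\Theta\vdash M'\Leftarrow\alpha$ are derivable. (3) If $R$ is an atomic term such that $\Theta'\vdash R\Rightarrow\alpha$ is derivable, then either there is an atomic term $R'$ such that $\theta(R)\rightsquigarrow_r R'$ and $\Theta\vdash R'\Rightarrow\alpha$ are derivable, or there is a canonical term $M$ such that $\theta(R)\rightsquigarrow_r M:\alpha$ and $\Theta\vdash M\Leftarrow\alpha$ are derivable.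
   Context: Canonical LF syntax: kinds $K ::= \mathrm{Type}\mid \Pi x{:}A.K$; canonical types $A ::= P \mid \Pi x{:}A_1.A_2$; atomic types $P ::= a\mid P\,M$; canonical terms $M ::= R\mid \lambda x.M$; atomic terms $R ::= c\mid x\mid R\,M$ ($c$ term constants, $a$ type constants, $x$ variables; identification up to renaming of bound variables). Arity types: $\alpha ::= o\mid \alpha\to\alpha$; erasure: $P^-=o$, $(\Pi x{:}A_1.A_2)^-=A_1^-\to A_2^-$. A substitution $\theta$ is a finite set $\{\langle x_i,M_i,\alpha_i\rangle\}$ with distinct variables $x_i$, canonical terms $M_i$, arity types $\alpha_i$; $\mathrm{dom}(\theta)=\{x_i\}$, $\mathrm{rng}(\theta)=\{M_i\}$, $\mathrm{ctx}(\theta)=\{x_i:\alpha_i\}$. Hereditary substitution judgements $\theta(M)\rightsquigarrow M'$, $\theta(R)\rightsquigarrow_r R'$, $\theta(R)\rightsquigarrow_r M':\alpha'$ are defined inductively by: if $\theta(R)\rightsquigarrow_r R'$ then $\theta(R)\rightsquigarrow R'$; if $\theta(R)\rightsquigarrow_r M':\alpha'$ then $\theta(R)\rightsquigarrow M'$; $\theta(\lambda x.M)\rightsquigarrow\lambda x.M'$ if $x\notin\mathrm{dom}(\theta)$, $x$ not free in $\mathrm{rng}(\theta)$, and $\theta(M)\rightsquigarrow M'$; $\theta(x)\rightsquigarrow_r M:\alpha$ if $\langle x,M,\alpha\rangle\in\theta$; $\theta(R\,M)\rightsquigarrow_r M''':\alpha''$ if $\theta(R)\rightsquigarrow_r\lambda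 x.M':\alpha'\to\alpha''$, $\theta(M)\rightsquigarrow M''$, $\{\langle x,M'',\alpha'\rangle\}(M')\rightsquigarrow M'''$; $\theta(c)\rightsquigarrow_r c$; $\theta(x)\rightsquigarrow_r x$ if $x\notin\mathrm{dom}(\theta)$; $\theta(R\,M)\rightsquigarrow_r R'\,M'$ if $\theta(R)\rightsquigarrow_r R'$ and $\theta(M)\rightsquigarrow M'$. On types/kinds it distributes to the terms ($\theta(a)\rightsquigarrow a$; $\theta(P\,M)\rightsquigarrow P'\,M'$; $\theta(\Pi x{:}A_1.A_2)\rightsquigarrow\Pi x{:}A_1'.A_2'$ with $x$ not in $\mathrm{dom}(\theta)$ nor free in $\mathrm{rng}(\theta)$; $\theta(\mathrm{Type})\rightsquigarrow\mathrm{Type}$; similarly for $\Pi x{:}A.K$). An arity context $\Theta$ is a set of unique assignments $x:\alpha$ or $c:\alpha$ of arity types to variables and term constants; $\Theta_1\oplus\Theta_2$ consists of the assignments in $\Theta_1$ together with those of $\Theta_2$ for symbols not assigned in $\Theta_1$. Arity typing: $\Theta\vdash c\Rightarrow\alpha$ if $c:\alpha\in\Theta$; $\Theta\vdash x\Rightarrow\alpha$ if $x:\alpha\in\Theta$; $\Theta\vdash R\,M\Rightarrow\alpha$ if $\Theta\vdash R\Rightarrow\alpha'\to\alpha$ and $\Theta\vdash M\Leftarrow\alpha'$; $\Theta\vdash\lambda x.M\Leftarrow\alpha_1\to\alpha_2$ if $\{x:\alpha_1\}\oplus\Theta\vdash M\Leftarrow\alpha_2$; $\Theta\vdash R\Leftarrow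 o$ if $\Theta\vdash R\Rightarrow o$. A kind or type $E$ respects $\Theta$ if: $E$ is $\mathrm{Type}$; or $E$ is an atomic type and each canonical term $M$ appearing as an argument in it satisfies $\Theta\vdash M\Leftarrow\alpha$ for some $\alpha$; or $E=\Pi x{:}A.E'$ with $A$ respecting $\Theta$ and $E'$ respecting $\{x:A^-\}\oplus\Theta$. $\theta$ is arity type preserving with respect to $\Theta$ if $\Theta\vdash M\Leftarrow\alpha$ for every $\langle x,M,\alpha\rangle\in\theta$. -}

module Defs where

open import Data.Nat using (ℕ) renaming (_≟_ to _≟ℕ_)
open import Data.Bool using (if_then_else_)
open import Data.Empty using (⊥)
open import Data.Unit using (⊤)
open import Data.Product using (_×_; _,_; proj₁; Σ; ∃; ∃-syntax)
open import Data.Sum using (_⊎_)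
open import Data.List using (List; []; _∷_; _++_; map; filter)
open import Data.List.Membership.Propositional using (_∈_)
open import Data.List.Relation.Unary.Any using (any?)
open import Data.List.Relation.Unary.Unique.Propositional using (Unique)
open import Relation.Nullary using (¬_; does; yes; no; ¬?)
open import Relation.Binary.PropositionalEquality using (_≡_; _≢_; refl; cong)
open import Relation.Binary.Definitions using (DecidableEquality)

Var : Set
Var = ℕ

Const : Set
Const = ℕ

TConst : Set
TConst = ℕ

-- Identification up to
-- renaming of bound variables is handled by the explicit α-equivalence
-- below, which the hereditary substitution judgements are closed under.

mutual
  data CTm : Set where
    at  : ATm → CTm
    lam : Var → CTm → CTm

  data ATm : Set where
    cst : Const → ATm
    var : Var → ATm
    app : ATm → CTm → ATm

data ATy : Set where
  tc   : TConst → ATy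
  tapp : ATy → CTm → ATy

data CTy : Set where
  atomT : ATy → CTy
  Π     : Var → CTy → CTy → CTy

data Kind : Set where
  Type : Kind
  ΠK   : Var → CTy → Kind → Kind

infixr 5 _⟶_
data Arity : Set where
  o   : Arity
  _⟶_ : Arity → Arity → Arity

_⁻ : CTy → Arity
atomT P ⁻   = o
Π x A₁ A₂ ⁻ = (A₁ ⁻) ⟶ (A₂ ⁻)

mutual
  FreeC : Var → CTm → Set
  FreeC x (at R)    = FreeA x R
  FreeC x (lam y M) = x ≢ y × FreeC x M

  FreeA : Var → ATm → Set
  FreeA x (cst c)   = ⊥
  FreeA x (var y)   = x ≡ y
  FreeA x (app R M) = FreeA x R ⊎ FreeC x M

FreeP : Var → ATy → Set
FreeP x (tc a)     = ⊥
FreeP x (tapp P M) = FreeP x P ⊎ FreeC x M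

FreeT : Var → CTy → Set
FreeT x (atomT P)   = FreeP x P
FreeT x (Π y A₁ A₂) = FreeT x A₁ ⊎ (x ≢ y × FreeT x A₂)

FreeK : Var → Kind → Set
FreeK x Type        = ⊥
FreeK x (ΠK y A K)  = FreeT x A ⊎ (x ≢ y × FreeK x K)

-- Swapping of names (used to define α-equivalence, Urban-style)

swapV : Var → Var → Var → Var
swapV x y z = if does (z ≟ℕ x) then y else (if does (z ≟ℕ y) then x else z)

mutual
  swapC : Var → Var → CTm → CTm
  swapC x y (at R)    = at (swapA x y R)
  swapC x y (lam z M) = lam (swapV x y z) (swapC x y M)

  swapA : Var → Var → ATm → ATm
  swapA x y (cst c)   = cst c
  swapA x y (var z)   = var (swapV x y z)
  swapA x y (app R M) = app (swapA x y R) (swapC x y M)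

swapP : Var → Var → ATy → ATy
swapP x y (tc a)     = tc a
swapP x y (tapp P M) = tapp (swapP x y P) (swapC x y M)

swapT : Var → Var → CTy → CTy
swapT x y (atomT P)   = atomT (swapP x y P)
swapT x y (Π z A₁ A₂) = Π (swapV x y z) (swapT x y A₁) (swapT x y A₂)

swapK : Var → Var → Kind → Kind
swapK x y Type       = Type
swapK x y (ΠK z A K) = ΠK (swapV x y z) (swapT x y A) (swapK x y K)

mutual
  data _=αC_ : CTm → CTm → Set where
    at  : ∀ {R R'} → R =αA R' → at R =αC at R'
    lam≡ : ∀ {x M M'} → M =αC M' → lam x M =αC lam x M'
    lam≢ : ∀ {x y M N} → x ≢ y → ¬ FreeC x N → M =αC swapC x y N →
           lam x M =αC lam y N

  data _=αA_ : ATm → ATm → Set where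
    cst : ∀ {c} → cst c =αA cst c
    var : ∀ {x} → var x =αA var x
    app : ∀ {R R' M M'} → R =αA R' → M =αC M' → app R M =αA app R' M'

data _=αP_ : ATy → ATy → Set where
  tc   : ∀ {a} → tc a =αP tc a
  tapp : ∀ {P P' M M'} → P =αP P' → M =αC M' → tapp P M =αP tapp P' M'

data _=αT_ : CTy → CTy → Set where
  atomT : ∀ {P P'} → P =αP P' → atomT P =αT atomT P'
  Π≡ : ∀ {x A₁ B₁ A₂ B₂} → A₁ =αT B₁ → A₂ =αT B₂ → Π x A₁ A₂ =αT Π x B₁ B₂
  Π≢ : ∀ {x y A₁ B₁ A₂ B₂} → A₁ =αT B₁ → x ≢ y → ¬ FreeT x B₂ →
       A₂ =αT swapT x y B₂ → Π x A₁ A₂ =αT Π y B₁ B₂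

data _=αK_ : Kind → Kind → Set where
  Type : Type =αK Type
  ΠK≡ : ∀ {x A B K L} → A =αT B → K =αK L → ΠK x A K =αK ΠK x B L
  ΠK≢ : ∀ {x y A B K L} → A =αT B → x ≢ y → ¬ FreeK x L →
        K =αK swapK x y L → ΠK x A K =αK ΠK y B L

Subst : Set
Subst = List (Var × CTm × Arity)

dom : Subst → List Var
dom = map proj₁

DistinctVars : Subst → Set
DistinctVars θ = Unique (dom θ)

NotInDom : Var → Subst → Set
NotInDom x θ = ¬ (x ∈ dom θ)

NotFreeInRng : Var → Subst → Set
NotFreeInRng x θ = ∀ {y M α} → (y , M , α) ∈ θ → ¬ FreeC x M

mutual
  data _⟦_⟧⇝_ (θ : Subst) : CTm → CTm → Set where
    atR  : ∀ {R R'} → θ ⟦ R ⟧⇝r R' → θ ⟦ at R ⟧⇝ at R'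
    atM  : ∀ {R M' α'} → θ ⟦ R ⟧⇝r M' ∶ α' → θ ⟦ at R ⟧⇝ M'
    -- λ-rule, for any representative λy.N of the α-class of λx.M
    lam  : ∀ {x M y N M'} → lam x M =αC lam y N →
           NotInDom y θ → NotFreeInRng y θ →
           θ ⟦ N ⟧⇝ M' → θ ⟦ lam x M ⟧⇝ lam y M'

  data _⟦_⟧⇝r_∶_ (θ : Subst) : ATm → CTm → Arity → Set where
    var : ∀ {x M α} → (x , M , α) ∈ θ → θ ⟦ var x ⟧⇝r M ∶ α
    app : ∀ {R M x M' α' α'' M'' M'''} →
          θ ⟦ R ⟧⇝r lam x M' ∶ (α' ⟶ α'') →
          θ ⟦ M ⟧⇝ M'' →
          ((x , M'' , α') ∷ []) ⟦ M' ⟧⇝ M''' →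
          θ ⟦ app R M ⟧⇝r M''' ∶ α''

  data _⟦_⟧⇝r_ (θ : Subst) : ATm → ATm → Set where
    cst : ∀ {c} → θ ⟦ cst c ⟧⇝r cst c
    var : ∀ {x} → NotInDom x θ → θ ⟦ var x ⟧⇝r var x
    app : ∀ {R R' M M'} → θ ⟦ R ⟧⇝r R' → θ ⟦ M ⟧⇝ M' →
          θ ⟦ app R M ⟧⇝r app R' M'

data _⟦_⟧⇝P_ (θ : Subst) : ATy → ATy → Set where
  tc   : ∀ {a} → θ ⟦ tc a ⟧⇝P tc a
  tapp : ∀ {P P' M M'} → θ ⟦ P ⟧⇝P P' → θ ⟦ M ⟧⇝ M' →
         θ ⟦ tapp P M ⟧⇝P tapp P' M'

data _⟦_⟧⇝T_ (θ : Subst) : CTy → CTy → Set where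
  atomT : ∀ {P P'} → θ ⟦ P ⟧⇝P P' → θ ⟦ atomT P ⟧⇝T atomT P'
  Π : ∀ {x A₁ A₂ y B₁ B₂ A₁' A₂'} → Π x A₁ A₂ =αT Π y B₁ B₂ →
      NotInDom y θ → NotFreeInRng y θ →
      θ ⟦ B₁ ⟧⇝T A₁' → θ ⟦ B₂ ⟧⇝T A₂' →
      θ ⟦ Π x A₁ A₂ ⟧⇝T Π y A₁' A₂'

data _⟦_⟧⇝K_ (θ : Subst) : Kind → Kind → Set where
  Type : θ ⟦ Type ⟧⇝K Type
  ΠK : ∀ {x A K y B L A' K'} → ΠK x A K =αK ΠK y B L →
       NotInDom y θ → NotFreeInRng y θ →
       θ ⟦ B ⟧⇝T A' → θ ⟦ L ⟧⇝K K' →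
       θ ⟦ ΠK x A K ⟧⇝K ΠK y A' K'

data Sym : Set where
  sv : Var → Sym
  sc : Const → Sym

_≟S_ : DecidableEquality Sym
sv x ≟S sv y with x ≟ℕ y
... | yes refl = yes refl
... | no ne    = no λ { refl → ne refl }
sv x ≟S sc c = no λ ()
sc c ≟S sv x = no λ ()
sc c ≟S sc d with c ≟ℕ d
... | yes refl = yes refl
... | no ne    = no λ { refl → ne refl }

ACtx : Set
ACtx = List (Sym × Arity)

UniqueAssign : ACtx → Set
UniqueAssign Θ = Unique (map proj₁ Θ)

infixr 4 _⊕_
_⊕_ : ACtx → ACtx → ACtx
Θ₁ ⊕ Θ₂ = Θ₁ ++ filter (λ p → ¬? (any? (λ q → proj₁ p ≟S proj₁ q) Θ₁)) Θ₂

ctx : Subst → ACtx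
ctx = map (λ { (x , M , α) → (sv x , α) })

mutual
  data _⊢_⇒_ (Θ : ACtx) : ATm → Arity → Set where
    cst : ∀ {c α} → (sc c , α) ∈ Θ → Θ ⊢ cst c ⇒ α
    var : ∀ {x α} → (sv x , α) ∈ Θ → Θ ⊢ var x ⇒ α
    app : ∀ {R M α' α} → Θ ⊢ R ⇒ (α' ⟶ α) → Θ ⊢ M ⇐ α' → Θ ⊢ app R M ⇒ α

  data _⊢_⇐_ (Θ : ACtx) : CTm → Arity → Set where
    lam : ∀ {x M α₁ α₂} → (((sv x , α₁) ∷ []) ⊕ Θ) ⊢ M ⇐ α₂ →
          Θ ⊢ lam x M ⇐ (α₁ ⟶ α₂)
    at  : ∀ {R} → Θ ⊢ R ⇒ o → Θ ⊢ at R ⇐ o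

RespectsP : ACtx → ATy → Set
RespectsP Θ (tc a)     = ⊤
RespectsP Θ (tapp P M) = RespectsP Θ P × ∃[ α ] (Θ ⊢ M ⇐ α)

RespectsT : ACtx → CTy → Set
RespectsT Θ (atomT P)   = RespectsP Θ P
RespectsT Θ (Π x A₁ A₂) = RespectsT Θ A₁ × RespectsT (((sv x , A₁ ⁻) ∷ []) ⊕ Θ) A₂

RespectsK : ACtx → Kind → Set
RespectsK Θ Type       = ⊤
RespectsK Θ (ΠK x A K) = RespectsT Θ A × RespectsK (((sv x , A ⁻) ∷ []) ⊕ Θ) K

ArityPreserving : Subst → ACtx → Set
ArityPreserving θ Θ = ∀ {x M α} → (x , M , α) ∈ θ → Θ ⊢ M ⇐ α

-- Hereditary substitution terminates by a lexicographic induction: first on the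
-- size of the largest arity type occurring in θ, then on the size of the term.
-- The only rule that starts a new substitution is the one for R M where θ(R) is
-- an abstraction λx.M′ : α′ → α″; it substitutes into M′ with the arity α′,
-- which is smaller than the arity in θ that α′ → α″ came from. Under a binder
-- the bound variable is swapped for a name larger than every name in θ and in
-- the body, which meets the side conditions of the λ- and Π-rules; swapping
-- preserves arity typing (away from the fresh name) and the size of terms.
module Submission where

open import Defs
open import Data.Nat using (ℕ; suc; _+_; _≤_; _<_; _⊔_; s≤s; _≟_)
open import Data.Nat.Properties using (≤-refl; ≤-trans; <-irrefl; ≤-<-trans; <-≤-trans; <⇒≤; <⇒≢; m≤m⊔n; m≤n⊔m; m⊔n<o⇒m<o; m⊔n<o⇒n<o; m≤m+n; m≤n+m)
open import Data.Nat.Induction using (<-rec)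
open import Data.Product using (_×_; _,_; proj₁; ∃-syntax)
open import Data.Sum using (_⊎_; inj₁; inj₂)
open import Data.Empty using (⊥-elim)
open import Data.Unit using (tt)
open import Data.List using ([]; _∷_)
open import Data.List.Membership.Propositional using (_∈_)
open import Data.List.Membership.Propositional.Properties using (∈-filter⁺; ∈-filter⁻; ∈-++⁺ˡ; ∈-++⁺ʳ; ∈-++⁻)
open import Data.List.Relation.Unary.Any using (Any; here; there; any?)
open import Relation.Nullary using (¬_; yes; no; ¬?)
open import Relation.Nullary.Decidable using (dec-true; dec-false)
open import Relation.Binary.PropositionalEquality using (_≡_; _≢_; refl; cong; cong₂; sym; trans; subst)

-- does (z ≟ x) in swapV normalises to z ≡ᵇ x, so with cannot abstract it; we rewrite instead.
swapV-left : ∀ x y → swapV x y x ≡ y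
swapV-left x y rewrite dec-true (x ≟ x) refl = refl

swapV-other : ∀ {x y z} → z ≢ x → z ≢ y → swapV x y z ≡ z
swapV-other {x} {y} {z} z≢x z≢y rewrite dec-false (z ≟ x) z≢x | dec-false (z ≟ y) z≢y = refl

swapV-right : ∀ x y → swapV x y y ≡ x
swapV-right x y with y ≟ x
... | yes refl = swapV-left y y
... | no y≢x rewrite dec-false (y ≟ x) y≢x | dec-true (y ≟ y) refl = refl

swapV-involutive : ∀ x y z → swapV x y (swapV x y z) ≡ z
swapV-involutive x y z with z ≟ x | z ≟ y
... | yes refl | _        rewrite swapV-left z y = swapV-right z y
... | no _     | yes refl rewrite swapV-right x z = swapV-left x z
... | no z≢x   | no z≢y   rewrite swapV-other z≢x z≢y = swapV-other z≢x z≢y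

swapV-self : ∀ y z → swapV y y z ≡ z
swapV-self y z with z ≟ y
... | yes refl = swapV-left z z
... | no z≢y   = swapV-other z≢y z≢y

mutual
  swapC-involutive : ∀ x y M → swapC x y (swapC x y M) ≡ M
  swapC-involutive x y (at R)    = cong at (swapA-involutive x y R)
  swapC-involutive x y (lam z M) = cong₂ lam (swapV-involutive x y z) (swapC-involutive x y M)

  swapA-involutive : ∀ x y R → swapA x y (swapA x y R) ≡ R
  swapA-involutive x y (cst c)   = refl
  swapA-involutive x y (var z)   = cong var (swapV-involutive x y z)
  swapA-involutive x y (app R M) = cong₂ app (swapA-involutive x y R) (swapC-involutive x y M)

swapP-involutive : ∀ x y P → swapP x y (swapP x y P) ≡ P
swapP-involutive x y (tc a)     = refl
swapP-involutive x y (tapp P M) = cong₂ tapp (swapP-involutive x y P) (swapC-involutive x y M)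

swapT-involutive : ∀ x y A → swapT x y (swapT x y A) ≡ A
swapT-involutive x y (atomT P) = cong atomT (swapP-involutive x y P)
swapT-involutive x y (Π z A B)
  rewrite swapV-involutive x y z | swapT-involutive x y A | swapT-involutive x y B = refl

swapK-involutive : ∀ x y K → swapK x y (swapK x y K) ≡ K
swapK-involutive x y Type = refl
swapK-involutive x y (ΠK z A K)
  rewrite swapV-involutive x y z | swapT-involutive x y A | swapK-involutive x y K = refl

mutual
  swapC-self : ∀ y M → swapC y y M ≡ M
  swapC-self y (at R)    = cong at (swapA-self y R)
  swapC-self y (lam z M) = cong₂ lam (swapV-self y z) (swapC-self y M)

  swapA-self : ∀ y R → swapA y y R ≡ R
  swapA-self y (cst c)   = refl
  swapA-self y (var z)   = cong var (swapV-self y z)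
  swapA-self y (app R M) = cong₂ app (swapA-self y R) (swapC-self y M)

swapT-⁻ : ∀ x y A → swapT x y A ⁻ ≡ A ⁻
swapT-⁻ x y (atomT P) = refl
swapT-⁻ x y (Π z A B) = cong₂ _⟶_ (swapT-⁻ x y A) (swapT-⁻ x y B)

=αT-⁻ : ∀ {A B} → A =αT B → A ⁻ ≡ B ⁻
=αT-⁻ (atomT _)  = refl
=αT-⁻ (Π≡ p q)   = cong₂ _⟶_ (=αT-⁻ p) (=αT-⁻ q)
=αT-⁻ {B = Π y B₁ B₂} (Π≢ {x = x} p _ _ q) =
  cong₂ _⟶_ (=αT-⁻ p) (trans (=αT-⁻ q) (swapT-⁻ x y B₂))

⇝T-⁻ : ∀ {θ A A'} → θ ⟦ A ⟧⇝T A' → A ⁻ ≡ A' ⁻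
⇝T-⁻ (atomT _)       = refl
⇝T-⁻ (Π A=B _ _ r s) = trans (=αT-⁻ A=B) (cong₂ _⟶_ (⇝T-⁻ r) (⇝T-⁻ s))

mutual
  =αC-refl : ∀ M → M =αC M
  =αC-refl (at R)    = at (=αA-refl R)
  =αC-refl (lam x M) = lam≡ (=αC-refl M)

  =αA-refl : ∀ R → R =αA R
  =αA-refl (cst c)   = cst
  =αA-refl (var x)   = var
  =αA-refl (app R M) = app (=αA-refl R) (=αC-refl M)

=αP-refl : ∀ P → P =αP P
=αP-refl (tc a)     = tc
=αP-refl (tapp P M) = tapp (=αP-refl P) (=αC-refl M)

=αT-refl : ∀ A → A =αT A
=αT-refl (atomT P) = atomT (=αP-refl P)
=αT-refl (Π x A B) = Π≡ (=αT-refl A) (=αT-refl B)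

=αK-refl : ∀ K → K =αK K
=αK-refl Type       = Type
=αK-refl (ΠK x A K) = ΠK≡ (=αT-refl A) (=αK-refl K)

lam=α-swap : ∀ {x y} M → x ≢ y → ¬ FreeC x (swapC x y M) →
  lam x M =αC lam y (swapC x y M)
lam=α-swap {x} {y} M x≢y x∉ =
  lam≢ x≢y x∉ (subst (M =αC_) (sym (swapC-involutive x y M)) (=αC-refl M))

Π=α-swap : ∀ {x y} A B → x ≢ y → ¬ FreeT x (swapT x y B) →
  Π x A B =αT Π y A (swapT x y B)
Π=α-swap {x} {y} A B x≢y x∉ =
  Π≢ (=αT-refl A) x≢y x∉ (subst (B =αT_) (sym (swapT-involutive x y B)) (=αT-refl B))

ΠK=α-swap : ∀ {x y} A K → x ≢ y → ¬ FreeK x (swapK x y K) →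
  ΠK x A K =αK ΠK y A (swapK x y K)
ΠK=α-swap {x} {y} A K x≢y x∉ =
  ΠK≢ (=αT-refl A) x≢y x∉ (subst (K =αK_) (sym (swapK-involutive x y K)) (=αK-refl K))

mutual
  maxVarC : CTm → ℕ
  maxVarC (at R)    = maxVarA R
  maxVarC (lam x M) = x ⊔ maxVarC M

  maxVarA : ATm → ℕ
  maxVarA (cst c)   = 0
  maxVarA (var x)   = x
  maxVarA (app R M) = maxVarA R ⊔ maxVarC M

maxVarP : ATy → ℕ
maxVarP (tc a)     = 0
maxVarP (tapp P M) = maxVarP P ⊔ maxVarC M

maxVarT : CTy → ℕ
maxVarT (atomT P) = maxVarP P
maxVarT (Π x A B) = x ⊔ (maxVarT A ⊔ maxVarT B)

maxVarK : Kind → ℕ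
maxVarK Type       = 0
maxVarK (ΠK x A K) = x ⊔ (maxVarT A ⊔ maxVarK K)

maxVarS : Subst → ℕ
maxVarS []                  = 0
maxVarS ((x , M , α) ∷ θ) = (x ⊔ maxVarC M) ⊔ maxVarS θ

mutual
  FreeC⇒≤maxVarC : ∀ {y} M → FreeC y M → y ≤ maxVarC M
  FreeC⇒≤maxVarC (at R)    y∈ = FreeA⇒≤maxVarA R y∈
  FreeC⇒≤maxVarC (lam x M) (_ , y∈) = ≤-trans (FreeC⇒≤maxVarC M y∈) (m≤n⊔m x (maxVarC M))

  FreeA⇒≤maxVarA : ∀ {y} R → FreeA y R → y ≤ maxVarA R
  FreeA⇒≤maxVarA (var x)   refl       = ≤-refl
  FreeA⇒≤maxVarA (app R M) (inj₁ y∈) = ≤-trans (FreeA⇒≤maxVarA R y∈) (m≤m⊔n (maxVarA R) (maxVarC M))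
  FreeA⇒≤maxVarA (app R M) (inj₂ y∈) = ≤-trans (FreeC⇒≤maxVarC M y∈) (m≤n⊔m (maxVarA R) (maxVarC M))

∈dom⇒≤maxVarS : ∀ θ {y} → y ∈ dom θ → y ≤ maxVarS θ
∈dom⇒≤maxVarS ((x , M , α) ∷ θ) (here refl) = ≤-trans (m≤m⊔n x (maxVarC M)) (m≤m⊔n _ (maxVarS θ))
∈dom⇒≤maxVarS ((x , M , α) ∷ θ) (there y∈) = ≤-trans (∈dom⇒≤maxVarS θ y∈) (m≤n⊔m _ (maxVarS θ))

∈⇒maxVarC≤maxVarS : ∀ θ {y M α} → (y , M , α) ∈ θ → maxVarC M ≤ maxVarS θ
∈⇒maxVarC≤maxVarS ((x , M , α) ∷ θ) (here refl) = ≤-trans (m≤n⊔m x (maxVarC M)) (m≤m⊔n _ (maxVarS θ))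
∈⇒maxVarC≤maxVarS ((x , M , α) ∷ θ) (there m)   = ≤-trans (∈⇒maxVarC≤maxVarS θ m) (m≤n⊔m _ (maxVarS θ))

>maxVarS⇒NotInDom : ∀ θ {y} → maxVarS θ < y → NotInDom y θ
>maxVarS⇒NotInDom θ θ<y y∈ = <-irrefl refl (≤-<-trans (∈dom⇒≤maxVarS θ y∈) θ<y)

>maxVarS⇒NotFreeInRng : ∀ θ {y} → maxVarS θ < y → NotFreeInRng y θ
>maxVarS⇒NotFreeInRng θ θ<y {M = M} m y∈ =
  <-irrefl refl (≤-<-trans (≤-trans (FreeC⇒≤maxVarC M y∈) (∈⇒maxVarC≤maxVarS θ m)) θ<y)

fresh : Subst → ℕ → Var
fresh θ m = suc (maxVarS θ ⊔ m)

maxVarS<fresh : ∀ θ m → maxVarS θ < fresh θ m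
maxVarS<fresh θ m = s≤s (m≤m⊔n (maxVarS θ) m)

<fresh : ∀ θ m → m < fresh θ m
<fresh θ m = s≤s (m≤n⊔m (maxVarS θ) m)

mutual
  swapC-¬FreeC : ∀ {x y} → x ≢ y → ∀ M → maxVarC M < y → ¬ FreeC x (swapC x y M)
  swapC-¬FreeC x≢y (at R)    M<y x∈ = swapA-¬FreeA x≢y R M<y x∈
  swapC-¬FreeC x≢y (lam z M) M<y (_ , x∈) = swapC-¬FreeC x≢y M (m⊔n<o⇒n<o z _ M<y) x∈

  swapA-¬FreeA : ∀ {x y} → x ≢ y → ∀ R → maxVarA R < y → ¬ FreeA x (swapA x y R)
  swapA-¬FreeA {x} {y} x≢y (var w) w<y x∈ with w ≟ x | w ≟ y
  ... | yes refl | _        = x≢y (trans x∈ (swapV-left x y))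
  ... | no _     | yes refl = <-irrefl refl w<y
  ... | no w≢x   | no w≢y   = w≢x (sym (trans x∈ (swapV-other w≢x w≢y)))
  swapA-¬FreeA x≢y (app R M) RM<y (inj₁ x∈) = swapA-¬FreeA x≢y R (m⊔n<o⇒m<o _ _ RM<y) x∈
  swapA-¬FreeA x≢y (app R M) RM<y (inj₂ x∈) = swapC-¬FreeC x≢y M (m⊔n<o⇒n<o _ _ RM<y) x∈

swapP-¬FreeP : ∀ {x y} → x ≢ y → ∀ P → maxVarP P < y → ¬ FreeP x (swapP x y P)
swapP-¬FreeP x≢y (tapp P M) PM<y (inj₁ x∈) = swapP-¬FreeP x≢y P (m⊔n<o⇒m<o _ _ PM<y) x∈
swapP-¬FreeP x≢y (tapp P M) PM<y (inj₂ x∈) = swapC-¬FreeC x≢y M (m⊔n<o⇒n<o _ _ PM<y) x∈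

swapT-¬FreeT : ∀ {x y} → x ≢ y → ∀ A → maxVarT A < y → ¬ FreeT x (swapT x y A)
swapT-¬FreeT x≢y (atomT P) P<y x∈ = swapP-¬FreeP x≢y P P<y x∈
swapT-¬FreeT x≢y (Π z A B) ΠAB<y (inj₁ x∈) =
  swapT-¬FreeT x≢y A (m⊔n<o⇒m<o _ _ (m⊔n<o⇒n<o z _ ΠAB<y)) x∈
swapT-¬FreeT x≢y (Π z A B) ΠAB<y (inj₂ (_ , x∈)) =
  swapT-¬FreeT x≢y B (m⊔n<o⇒n<o _ _ (m⊔n<o⇒n<o z _ ΠAB<y)) x∈

swapK-¬FreeK : ∀ {x y} → x ≢ y → ∀ K → maxVarK K < y → ¬ FreeK x (swapK x y K)
swapK-¬FreeK x≢y (ΠK z A K) ΠAK<y (inj₁ x∈) =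
  swapT-¬FreeT x≢y A (m⊔n<o⇒m<o _ _ (m⊔n<o⇒n<o z _ ΠAK<y)) x∈
swapK-¬FreeK x≢y (ΠK z A K) ΠAK<y (inj₂ (_ , x∈)) =
  swapK-¬FreeK x≢y K (m⊔n<o⇒n<o _ _ (m⊔n<o⇒n<o z _ ΠAK<y)) x∈

Unassigned : Sym → ACtx → Set
Unassigned s Θ = ¬ Any (λ q → s ≡ proj₁ q) Θ

∈-⊕⁺ˡ : ∀ {Θ₁ Θ₂ p} → p ∈ Θ₁ → p ∈ (Θ₁ ⊕ Θ₂)
∈-⊕⁺ˡ = ∈-++⁺ˡ

∈-⊕⁺ʳ : ∀ {Θ₁ Θ₂ s a} → Unassigned s Θ₁ → (s , a) ∈ Θ₂ → (s , a) ∈ (Θ₁ ⊕ Θ₂)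
∈-⊕⁺ʳ {Θ₁} s∉ s∈ = ∈-++⁺ʳ Θ₁ (∈-filter⁺ (λ p → ¬? (any? (λ q → proj₁ p ≟S proj₁ q) Θ₁)) s∈ s∉)

∈-⊕⁻ : ∀ {Θ₁ Θ₂ s a} → (s , a) ∈ (Θ₁ ⊕ Θ₂) →
  (s , a) ∈ Θ₁ ⊎ (Unassigned s Θ₁ × (s , a) ∈ Θ₂)
∈-⊕⁻ {Θ₁} {Θ₂} s∈ with ∈-++⁻ Θ₁ s∈
... | inj₁ s∈Θ₁ = inj₁ s∈Θ₁
... | inj₂ s∈filter with ∈-filter⁻ (λ p → ¬? (any? (λ q → proj₁ p ≟S proj₁ q) Θ₁)) {xs = Θ₂} s∈filter
...   | s∈Θ₂ , s∉Θ₁ = inj₂ (s∉Θ₁ , s∈Θ₂)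

∈-∷⊕⁻ : ∀ {z b Γ s a} → (s , a) ∈ (((sv z , b) ∷ []) ⊕ Γ) →
  (s ≡ sv z × a ≡ b) ⊎ (s ≢ sv z × (s , a) ∈ Γ)
∈-∷⊕⁻ {z} {b} {Γ} s∈ with ∈-⊕⁻ {(sv z , b) ∷ []} {Γ} s∈
... | inj₁ (here refl)   = inj₁ (refl , refl)
... | inj₂ (s∉ , s∈Γ) = inj₂ ((λ s≡z → s∉ (here s≡z)) , s∈Γ)

∈-∷⊕⁺ʳ : ∀ {z b Γ s a} → s ≢ sv z → (s , a) ∈ Γ → (s , a) ∈ (((sv z , b) ∷ []) ⊕ Γ)
∈-∷⊕⁺ʳ s≢z = ∈-⊕⁺ʳ λ { (here s≡z) → s≢z s≡z ; (there ()) }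

∈-ctx⁻ : ∀ θ {x α} → (sv x , α) ∈ ctx θ → ∃[ M ] ((x , M , α) ∈ θ)
∈-ctx⁻ ((y , N , β) ∷ θ) (here refl) = N , here refl
∈-ctx⁻ ((y , N , β) ∷ θ) (there x∈) with ∈-ctx⁻ θ x∈
... | M , x∈θ = M , there x∈θ

sc∉ctx : ∀ θ {c α} → ¬ (sc c , α) ∈ ctx θ
sc∉ctx ((y , N , β) ∷ θ) (there c∈) = sc∉ctx θ c∈

Unassigned-ctx⇒NotInDom : ∀ θ {x} → Unassigned (sv x) (ctx θ) → NotInDom x θ
Unassigned-ctx⇒NotInDom ((y , N , β) ∷ θ) x∉ (here refl) = x∉ (here refl)
Unassigned-ctx⇒NotInDom ((y , N , β) ∷ θ) x∉ (there x∈) =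
  Unassigned-ctx⇒NotInDom θ (λ x∈ctx → x∉ (there x∈ctx)) x∈

NotInDom⇒Unassigned-ctx : ∀ θ {x} → NotInDom x θ → Unassigned (sv x) (ctx θ)
NotInDom⇒Unassigned-ctx ((y , N , β) ∷ θ) x∉ (here refl) = x∉ (here refl)
NotInDom⇒Unassigned-ctx ((y , N , β) ∷ θ) x∉ (there x∈) =
  NotInDom⇒Unassigned-ctx θ (λ x∈dom → x∉ (there x∈dom)) x∈

swapS : Var → Var → Sym → Sym
swapS x y (sv z) = sv (swapV x y z)
swapS x y (sc c) = sc c

swapS-involutive : ∀ x y s → swapS x y (swapS x y s) ≡ s
swapS-involutive x y (sv z) = cong sv (swapV-involutive x y z)
swapS-involutive x y (sc c) = refl

swapS-injective : ∀ x y {s t} → swapS x y s ≡ swapS x y t → s ≡ t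
swapS-injective x y {s} {t} eq =
  trans (sym (swapS-involutive x y s)) (trans (cong (swapS x y) eq) (swapS-involutive x y t))

swapS-other : ∀ {x y s} → s ≢ sv x → s ≢ sv y → swapS x y s ≡ s
swapS-other {s = sv z} z≢x z≢y = cong sv (swapV-other (λ eq → z≢x (cong sv eq)) (λ eq → z≢y (cong sv eq)))
swapS-other {s = sc c} _   _   = refl

swapS-self : ∀ y s → swapS y y s ≡ s
swapS-self y (sv z) = cong sv (swapV-self y z)
swapS-self y (sc c) = refl

-- y is meant to be fresh for the renamed syntax, so its assignments in Γ are irrelevant.
SwapCompatible : Var → Var → ACtx → ACtx → Set
SwapCompatible x y Γ Δ = ∀ {s a} → s ≢ sv y → (s , a) ∈ Γ → (swapS x y s , a) ∈ Δ

SwapCompatible-∷⊕ : ∀ {x y Γ Δ z b} → SwapCompatible x y Γ Δ →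
  SwapCompatible x y (((sv z , b) ∷ []) ⊕ Γ) (((sv (swapV x y z) , b) ∷ []) ⊕ Δ)
SwapCompatible-∷⊕ {x} {y} {Γ} {Δ} {z} {b} Γ~Δ s≢y s∈ with ∈-∷⊕⁻ {z} {b} {Γ} s∈
... | inj₁ (refl , refl)  = here refl
... | inj₂ (s≢z , s∈Γ) = ∈-∷⊕⁺ʳ (λ eq → s≢z (swapS-injective x y eq)) (Γ~Δ s≢y s∈Γ)

mutual
  swap-⇐ : ∀ {x y Γ Δ α} M → maxVarC M < y → SwapCompatible x y Γ Δ →
    Γ ⊢ M ⇐ α → Δ ⊢ swapC x y M ⇐ α
  swap-⇐ (at R)    R<y Γ~Δ (at d)  = at (swap-⇒ R R<y Γ~Δ d)
  swap-⇐ (lam z M) M<y Γ~Δ (lam d) = lam (swap-⇐ M (m⊔n<o⇒n<o z _ M<y) (SwapCompatible-∷⊕ Γ~Δ) d)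

  swap-⇒ : ∀ {x y Γ Δ α} R → maxVarA R < y → SwapCompatible x y Γ Δ →
    Γ ⊢ R ⇒ α → Δ ⊢ swapA x y R ⇒ α
  swap-⇒ (cst c)   _   Γ~Δ (cst c∈) = cst (Γ~Δ (λ ()) c∈)
  swap-⇒ (var w)   w<y Γ~Δ (var w∈) = var (Γ~Δ (λ { refl → <-irrefl refl w<y }) w∈)
  swap-⇒ (app R M) RM<y Γ~Δ (app d e) =
    app (swap-⇒ R (m⊔n<o⇒m<o _ _ RM<y) Γ~Δ d) (swap-⇐ M (m⊔n<o⇒n<o _ _ RM<y) Γ~Δ e)

swap-RespectsP : ∀ {x y Γ Δ} P → maxVarP P < y → SwapCompatible x y Γ Δ →
  RespectsP Γ P → RespectsP Δ (swapP x y P)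
swap-RespectsP (tc a)     _    _   _            = tt
swap-RespectsP (tapp P M) PM<y Γ~Δ (ρ , α , d) =
  swap-RespectsP P (m⊔n<o⇒m<o _ _ PM<y) Γ~Δ ρ , α , swap-⇐ M (m⊔n<o⇒n<o _ _ PM<y) Γ~Δ d

swap-RespectsT : ∀ {x y Γ Δ} A → maxVarT A < y → SwapCompatible x y Γ Δ →
  RespectsT Γ A → RespectsT Δ (swapT x y A)
swap-RespectsT (atomT P) P<y Γ~Δ ρ = swap-RespectsP P P<y Γ~Δ ρ
swap-RespectsT {x} {y} {Γ} {Δ} (Π z A B) ΠAB<y Γ~Δ (ρA , ρB) =
  swap-RespectsT A (m⊔n<o⇒m<o _ _ (m⊔n<o⇒n<o z _ ΠAB<y)) Γ~Δ ρA ,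
  subst (λ a → RespectsT (((sv (swapV x y z) , a) ∷ []) ⊕ Δ) (swapT x y B)) (sym (swapT-⁻ x y A))
    (swap-RespectsT B (m⊔n<o⇒n<o _ _ (m⊔n<o⇒n<o z _ ΠAB<y)) (SwapCompatible-∷⊕ Γ~Δ) ρB)

swap-RespectsK : ∀ {x y Γ Δ} K → maxVarK K < y → SwapCompatible x y Γ Δ →
  RespectsK Γ K → RespectsK Δ (swapK x y K)
swap-RespectsK Type _ _ _ = tt
swap-RespectsK {x} {y} {Γ} {Δ} (ΠK z A K) ΠAK<y Γ~Δ (ρA , ρK) =
  swap-RespectsT A (m⊔n<o⇒m<o _ _ (m⊔n<o⇒n<o z _ ΠAK<y)) Γ~Δ ρA ,
  subst (λ a → RespectsK (((sv (swapV x y z) , a) ∷ []) ⊕ Δ) (swapK x y K)) (sym (swapT-⁻ x y A))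
    (swap-RespectsK K (m⊔n<o⇒n<o _ _ (m⊔n<o⇒n<o z _ ΠAK<y)) (SwapCompatible-∷⊕ Γ~Δ) ρK)

-- The renamed binder moves behind ctx θ, which cannot shadow it since y ∉ dom θ.
SwapCompatible-binder : ∀ θ {Θ x y a} → NotInDom y θ →
  SwapCompatible x y (((sv x , a) ∷ []) ⊕ (ctx θ ⊕ Θ)) (ctx θ ⊕ (((sv y , a) ∷ []) ⊕ Θ))
SwapCompatible-binder θ {Θ} {x} {y} {a} y∉θ {s} s≢y s∈ with ∈-∷⊕⁻ {x} {a} {ctx θ ⊕ Θ} s∈
... | inj₁ (refl , refl) rewrite swapV-left x y = ∈-⊕⁺ʳ {ctx θ} (NotInDom⇒Unassigned-ctx θ y∉θ) (here refl)
... | inj₂ (s≢x , s∈') rewrite swapS-other {x} {y} {s} s≢x s≢y with ∈-⊕⁻ {ctx θ} {Θ} s∈'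
...   | inj₁ s∈ctx       = ∈-⊕⁺ˡ s∈ctx
...   | inj₂ (s∉ , s∈Θ) = ∈-⊕⁺ʳ {ctx θ} s∉ (∈-∷⊕⁺ʳ s≢y s∈Θ)

-- Weakening is renaming along the trivial swap of y with itself.
ArityPreserving-∷⊕ : ∀ θ {Θ y β} → maxVarS θ < y → ArityPreserving θ Θ →
  ArityPreserving θ (((sv y , β) ∷ []) ⊕ Θ)
ArityPreserving-∷⊕ θ {Θ} {y} {β} θ<y θ⇐ {M = M} m =
  subst (λ N → _ ⊢ N ⇐ _) (swapC-self y M)
    (swap-⇐ M (≤-<-trans (∈⇒maxVarC≤maxVarS θ m) θ<y) Θ~Θ' (θ⇐ m))
  where
  Θ~Θ' : SwapCompatible y y Θ (((sv y , β) ∷ []) ⊕ Θ)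
  Θ~Θ' {s} s≢y s∈ = subst (λ t → (t , _) ∈ (((sv y , β) ∷ []) ⊕ Θ)) (sym (swapS-self y s)) (∈-∷⊕⁺ʳ s≢y s∈)

size : Arity → ℕ
size o       = 0
size (α ⟶ β) = suc (size α + size β)

size-dom< : ∀ α β → size α < size (α ⟶ β)
size-dom< α β = s≤s (m≤m+n (size α) (size β))

size-cod< : ∀ α β → size β < size (α ⟶ β)
size-cod< α β = s≤s (m≤n+m (size β) (size α))

mutual
  sizeC : CTm → ℕ
  sizeC (at R)    = suc (sizeA R)
  sizeC (lam x M) = suc (sizeC M)

  sizeA : ATm → ℕ
  sizeA (cst c)   = 0
  sizeA (var x)   = 0
  sizeA (app R M) = suc (sizeA R + sizeC M)

sizeT : CTy → ℕ
sizeT (atomT P) = 0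
sizeT (Π x A B) = suc (sizeT A + sizeT B)

sizeK : Kind → ℕ
sizeK Type       = 0
sizeK (ΠK x A K) = suc (sizeK K)

mutual
  sizeC-swap : ∀ x y M → sizeC (swapC x y M) ≡ sizeC M
  sizeC-swap x y (at R)    = cong suc (sizeA-swap x y R)
  sizeC-swap x y (lam z M) = cong suc (sizeC-swap x y M)

  sizeA-swap : ∀ x y R → sizeA (swapA x y R) ≡ sizeA R
  sizeA-swap x y (cst c)   = refl
  sizeA-swap x y (var z)   = refl
  sizeA-swap x y (app R M) = cong suc (cong₂ _+_ (sizeA-swap x y R) (sizeC-swap x y M))

sizeT-swap : ∀ x y A → sizeT (swapT x y A) ≡ sizeT A
sizeT-swap x y (atomT P) = refl
sizeT-swap x y (Π z A B) = cong suc (cong₂ _+_ (sizeT-swap x y A) (sizeT-swap x y B))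

sizeK-swap : ∀ x y K → sizeK (swapK x y K) ≡ sizeK K
sizeK-swap x y Type       = refl
sizeK-swap x y (ΠK z A K) = cong suc (sizeK-swap x y K)

AritiesBounded : ℕ → Subst → Set
AritiesBounded n θ = ∀ {x M α} → (x , M , α) ∈ θ → size α ≤ n

maxArity : Subst → ℕ
maxArity []                  = 0
maxArity ((x , M , α) ∷ θ) = size α ⊔ maxArity θ

AritiesBounded-maxArity : ∀ θ → AritiesBounded (maxArity θ) θ
AritiesBounded-maxArity ((x , M , α) ∷ θ) (here refl) = m≤m⊔n _ _
AritiesBounded-maxArity ((x , M , α) ∷ θ) (there m)   = ≤-trans (AritiesBounded-maxArity θ m) (m≤n⊔m _ _)

-- Hereditary substitution on terms

Hsubst⇐ : ℕ → Set
Hsubst⇐ n = ∀ θ Θ → ArityPreserving θ Θ → AritiesBounded n θ →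
  ∀ {M α} → (ctx θ ⊕ Θ) ⊢ M ⇐ α → ∃[ M' ] (θ ⟦ M ⟧⇝ M' × Θ ⊢ M' ⇐ α)

-- The bound on α in the second alternative is what makes the outer induction go through.
Hsubst⇒Result : ℕ → Subst → ACtx → ATm → Arity → Set
Hsubst⇒Result n θ Θ R α =
  ∃[ R' ] (θ ⟦ R ⟧⇝r R' × Θ ⊢ R' ⇒ α) ⊎ ∃[ M ] (θ ⟦ R ⟧⇝r M ∶ α × Θ ⊢ M ⇐ α × size α ≤ n)

module Lexicographic (n : ℕ) (hsubst-⇐-below : ∀ {m} → m < n → Hsubst⇐ m) where

  mutual
    ⇐-fuel : ∀ k θ Θ → ArityPreserving θ Θ → AritiesBounded n θ → ∀ {M α} →
      sizeC M < k → (ctx θ ⊕ Θ) ⊢ M ⇐ α → ∃[ M' ] (θ ⟦ M ⟧⇝ M' × Θ ⊢ M' ⇐ α)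
    ⇐-fuel (suc k) θ Θ θ⇐ θ≤n (s≤s R<k) (at d) with ⇒-fuel k θ Θ θ⇐ θ≤n R<k d
    ... | inj₁ (R' , r , t)     = at R' , atR r , at t
    ... | inj₂ (M' , r , t , _) = M' , atM r , t
    ⇐-fuel (suc k) θ Θ θ⇐ θ≤n (s≤s M<k) (lam {x} {M} d) =
      ⇐-lam k θ Θ θ⇐ θ≤n (maxVarS<fresh θ (x ⊔ maxVarC M)) (<fresh θ (x ⊔ maxVarC M)) M<k d

    ⇐-lam : ∀ k θ Θ → ArityPreserving θ Θ → AritiesBounded n θ → ∀ {x M α₁ α₂ y} →
      maxVarS θ < y → x ⊔ maxVarC M < y → sizeC M < k →
      (((sv x , α₁) ∷ []) ⊕ (ctx θ ⊕ Θ)) ⊢ M ⇐ α₂ →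
      ∃[ M' ] (θ ⟦ lam x M ⟧⇝ M' × Θ ⊢ M' ⇐ (α₁ ⟶ α₂))
    ⇐-lam k θ Θ θ⇐ θ≤n {x} {M} {α₁} {y = y} θ<y xM<y M<k d =
      let (M' , r , t) = ⇐-fuel k θ (((sv y , α₁) ∷ []) ⊕ Θ) (ArityPreserving-∷⊕ θ θ<y θ⇐) θ≤n
                           (subst (_< k) (sym (sizeC-swap x y M)) M<k)
                           (swap-⇐ M maxVarM<y (SwapCompatible-binder θ {Θ} (>maxVarS⇒NotInDom θ θ<y)) d)
      in lam y M' ,
         lam (lam=α-swap M x≢y (swapC-¬FreeC x≢y M maxVarM<y))
             (>maxVarS⇒NotInDom θ θ<y) (>maxVarS⇒NotFreeInRng θ θ<y) r ,
         lam t
      where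
      x≢y : x ≢ y
      x≢y = <⇒≢ (m⊔n<o⇒m<o _ _ xM<y)
      maxVarM<y : maxVarC M < y
      maxVarM<y = m⊔n<o⇒n<o _ _ xM<y

    ⇒-fuel : ∀ k θ Θ → ArityPreserving θ Θ → AritiesBounded n θ → ∀ {R α} →
      sizeA R < k → (ctx θ ⊕ Θ) ⊢ R ⇒ α → Hsubst⇒Result n θ Θ R α
    ⇒-fuel (suc k) θ Θ θ⇐ θ≤n _ (cst c∈) with ∈-⊕⁻ {ctx θ} {Θ} c∈
    ... | inj₁ c∈ctx      = ⊥-elim (sc∉ctx θ c∈ctx)
    ... | inj₂ (_ , c∈Θ) = inj₁ (cst _ , cst , cst c∈Θ)
    ⇒-fuel (suc k) θ Θ θ⇐ θ≤n _ (var x∈) with ∈-⊕⁻ {ctx θ} {Θ} x∈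
    ... | inj₁ x∈ctx = let (M , x∈θ) = ∈-ctx⁻ θ x∈ctx in inj₂ (M , var x∈θ , θ⇐ x∈θ , θ≤n x∈θ)
    ... | inj₂ (x∉ctx , x∈Θ) = inj₁ (var _ , var (Unassigned-ctx⇒NotInDom θ x∉ctx) , var x∈Θ)
    ⇒-fuel (suc k) θ Θ θ⇐ θ≤n (s≤s RM<k) (app {α' = α'} {α = α} d e)
      with ⇒-fuel k θ Θ θ⇐ θ≤n (≤-<-trans (m≤m+n _ _) RM<k) d
         | ⇐-fuel k θ Θ θ⇐ θ≤n (≤-<-trans (m≤n+m _ _) RM<k) e
    ... | inj₁ (R' , r , t) | M' , r' , t' = inj₁ (app R' M' , app r r' , app t t')
    ... | inj₂ (lam z N , r , lam t , α'α≤n) | M' , r' , t' =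
      let (N' , r'' , t'') = hsubst-⇐-below (<-≤-trans (size-dom< α' α) α'α≤n)
                               ((z , M' , α') ∷ []) Θ
                               (λ { (here refl) → t' ; (there ()) })
                               (λ { (here refl) → ≤-refl ; (there ()) })
                               t
      in inj₂ (N' , app r r' r'' , t'' , <⇒≤ (<-≤-trans (size-cod< α' α) α'α≤n))

hsubst-⇐ : ∀ n → Hsubst⇐ n
hsubst-⇐ = <-rec Hsubst⇐ λ n below θ Θ θ⇐ θ≤n {M} d →
  Lexicographic.⇐-fuel n below (suc (sizeC M)) θ Θ θ⇐ θ≤n ≤-refl d

hsubst-⇒ : ∀ n θ Θ → ArityPreserving θ Θ → AritiesBounded n θ →
  ∀ {R α} → (ctx θ ⊕ Θ) ⊢ R ⇒ α → Hsubst⇒Result n θ Θ R α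
hsubst-⇒ n θ Θ θ⇐ θ≤n {R} d =
  Lexicographic.⇒-fuel n (λ {m} _ → hsubst-⇐ m) (suc (sizeA R)) θ Θ θ⇐ θ≤n ≤-refl d

-- Hereditary substitution on types and kinds

module _ {n : ℕ} (θ : Subst) (θ≤n : AritiesBounded n θ) where

  hsubst-RespectsP : ∀ Θ → ArityPreserving θ Θ → ∀ {P} → RespectsP (ctx θ ⊕ Θ) P →
    ∃[ P' ] (RespectsP Θ P' × θ ⟦ P ⟧⇝P P')
  hsubst-RespectsP Θ θ⇐ {tc a} _ = tc a , tt , tc
  hsubst-RespectsP Θ θ⇐ {tapp P M} (ρ , α , d) =
    let (P' , ρ' , r) = hsubst-RespectsP Θ θ⇐ ρ
        (M' , r' , t) = hsubst-⇐ n θ Θ θ⇐ θ≤n d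
    in tapp P' M' , (ρ' , α , t) , tapp r r'

  mutual
    RespectsT-fuel : ∀ k Θ → ArityPreserving θ Θ → ∀ {A} → sizeT A < k →
      RespectsT (ctx θ ⊕ Θ) A → ∃[ A' ] (RespectsT Θ A' × θ ⟦ A ⟧⇝T A')
    RespectsT-fuel (suc k) Θ θ⇐ {atomT P} _ ρ =
      let (P' , ρ' , r) = hsubst-RespectsP Θ θ⇐ ρ in atomT P' , ρ' , atomT r
    RespectsT-fuel (suc k) Θ θ⇐ {Π x A B} (s≤s AB<k) ρ =
      RespectsΠ k Θ θ⇐ (maxVarS<fresh θ (x ⊔ maxVarT B)) (<fresh θ (x ⊔ maxVarT B)) AB<k ρ

    RespectsΠ : ∀ k Θ → ArityPreserving θ Θ → ∀ {x A B y} →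
      maxVarS θ < y → x ⊔ maxVarT B < y → sizeT A + sizeT B < k →
      RespectsT (ctx θ ⊕ Θ) (Π x A B) → ∃[ C ] (RespectsT Θ C × θ ⟦ Π x A B ⟧⇝T C)
    RespectsΠ k Θ θ⇐ {x} {A} {B} {y} θ<y xB<y AB<k (ρA , ρB) =
      let (A' , ρA' , rA) = RespectsT-fuel k Θ θ⇐ (≤-<-trans (m≤m+n _ _) AB<k) ρA
          (B' , ρB' , rB) = RespectsT-fuel k (((sv y , A ⁻) ∷ []) ⊕ Θ) (ArityPreserving-∷⊕ θ θ<y θ⇐)
                              (subst (_< k) (sym (sizeT-swap x y B)) (≤-<-trans (m≤n+m _ _) AB<k))
                              (swap-RespectsT B maxVarB<y (SwapCompatible-binder θ {Θ} (>maxVarS⇒NotInDom θ θ<y)) ρB)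
      in Π y A' B' ,
         (ρA' , subst (λ a → RespectsT (((sv y , a) ∷ []) ⊕ Θ) B') (⇝T-⁻ rA) ρB') ,
         Π (Π=α-swap A B x≢y (swapT-¬FreeT x≢y B maxVarB<y))
           (>maxVarS⇒NotInDom θ θ<y) (>maxVarS⇒NotFreeInRng θ θ<y) rA rB
      where
      x≢y : x ≢ y
      x≢y = <⇒≢ (m⊔n<o⇒m<o _ _ xB<y)
      maxVarB<y : maxVarT B < y
      maxVarB<y = m⊔n<o⇒n<o _ _ xB<y

  hsubst-RespectsT : ∀ Θ → ArityPreserving θ Θ → ∀ {A} → RespectsT (ctx θ ⊕ Θ) A →
    ∃[ A' ] (RespectsT Θ A' × θ ⟦ A ⟧⇝T A')
  hsubst-RespectsT Θ θ⇐ {A} = RespectsT-fuel (suc (sizeT A)) Θ θ⇐ ≤-refl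

  mutual
    RespectsK-fuel : ∀ k Θ → ArityPreserving θ Θ → ∀ {K} → sizeK K < k →
      RespectsK (ctx θ ⊕ Θ) K → ∃[ K' ] (RespectsK Θ K' × θ ⟦ K ⟧⇝K K')
    RespectsK-fuel (suc k) Θ θ⇐ {Type} _ _ = Type , tt , Type
    RespectsK-fuel (suc k) Θ θ⇐ {ΠK x A K} (s≤s K<k) ρ =
      RespectsΠK k Θ θ⇐ (maxVarS<fresh θ (x ⊔ maxVarK K)) (<fresh θ (x ⊔ maxVarK K)) K<k ρ

    RespectsΠK : ∀ k Θ → ArityPreserving θ Θ → ∀ {x A K y} →
      maxVarS θ < y → x ⊔ maxVarK K < y → sizeK K < k →
      RespectsK (ctx θ ⊕ Θ) (ΠK x A K) → ∃[ L ] (RespectsK Θ L × θ ⟦ ΠK x A K ⟧⇝K L)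
    RespectsΠK k Θ θ⇐ {x} {A} {K} {y} θ<y xK<y K<k (ρA , ρK) =
      let (A' , ρA' , rA) = hsubst-RespectsT Θ θ⇐ ρA
          (K' , ρK' , rK) = RespectsK-fuel k (((sv y , A ⁻) ∷ []) ⊕ Θ) (ArityPreserving-∷⊕ θ θ<y θ⇐)
                              (subst (_< k) (sym (sizeK-swap x y K)) K<k)
                              (swap-RespectsK K maxVarK<y (SwapCompatible-binder θ {Θ} (>maxVarS⇒NotInDom θ θ<y)) ρK)
      in ΠK y A' K' ,
         (ρA' , subst (λ a → RespectsK (((sv y , a) ∷ []) ⊕ Θ) K') (⇝T-⁻ rA) ρK') ,
         ΠK (ΠK=α-swap A K x≢y (swapK-¬FreeK x≢y K maxVarK<y))
            (>maxVarS⇒NotInDom θ θ<y) (>maxVarS⇒NotFreeInRng θ θ<y) rA rK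
      where
      x≢y : x ≢ y
      x≢y = <⇒≢ (m⊔n<o⇒m<o _ _ xK<y)
      maxVarK<y : maxVarK K < y
      maxVarK<y = m⊔n<o⇒n<o _ _ xK<y

  hsubst-RespectsK : ∀ Θ → ArityPreserving θ Θ → ∀ {K} → RespectsK (ctx θ ⊕ Θ) K →
    ∃[ K' ] (RespectsK Θ K' × θ ⟦ K ⟧⇝K K')
  hsubst-RespectsK Θ θ⇐ {K} = RespectsK-fuel (suc (sizeK K)) Θ θ⇐ ≤-refl

theorem2p4 : (θ : Subst) (Θ : ACtx) →
    DistinctVars θ → UniqueAssign Θ → ArityPreserving θ Θ →
    ((A : CTy) → RespectsT (ctx θ ⊕ Θ) A →
       ∃[ A' ] (RespectsT Θ A' × θ ⟦ A ⟧⇝T A'))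
    × ((K : Kind) → RespectsK (ctx θ ⊕ Θ) K →
       ∃[ K' ] (RespectsK Θ K' × θ ⟦ K ⟧⇝K K'))
    × ((M : CTm) (α : Arity) → (ctx θ ⊕ Θ) ⊢ M ⇐ α →
       ∃[ M' ] (θ ⟦ M ⟧⇝ M' × Θ ⊢ M' ⇐ α))
    × ((R : ATm) (α : Arity) → (ctx θ ⊕ Θ) ⊢ R ⇒ α →
       (∃[ R' ] (θ ⟦ R ⟧⇝r R' × Θ ⊢ R' ⇒ α))
       ⊎ (∃[ M ] (θ ⟦ R ⟧⇝r M ∶ α × Θ ⊢ M ⇐ α)))
theorem2p4 θ Θ _ _ θ⇐ =
  (λ A → hsubst-RespectsT θ θ≤n Θ θ⇐) ,
  (λ K → hsubst-RespectsK θ θ≤n Θ θ⇐) ,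
  (λ M α → hsubst-⇐ n θ Θ θ⇐ θ≤n) ,
  (λ R α d → forget-bound (hsubst-⇒ n θ Θ θ⇐ θ≤n d))
  where
  n : ℕ
  n = maxArity θ
  θ≤n : AritiesBounded n θ
  θ≤n = AritiesBounded-maxArity θ
  forget-bound : ∀ {R α} → Hsubst⇒Result n θ Θ R α →
    ∃[ R' ] (θ ⟦ R ⟧⇝r R' × Θ ⊢ R' ⇒ α) ⊎ ∃[ M ] (θ ⟦ R ⟧⇝r M ∶ α × Θ ⊢ M ⇐ α)
  forget-bound (inj₁ r)               = inj₁ r
  forget-bound (inj₂ (M , r , t , _)) = inj₂ (M , r , t)
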